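{- Let $n \ge 2$ and define $u = u^n, v = v^n \in \mathbb{R}^{\binom{n}{2}}$ by $u_{ij} = n(n - \min(i,j))$ and $v_{ij} = \max(i,j) - 1$ for $1 \le i < j \le n$ (these are ultrametrics of equidistant trees on leaf set $[n]$). Along the tropical line segment from $v^n$ to $u^n$ there are exactly $\binom{n-1}{2}$ single NNIs and no four clade rearrangements. That is, exactly $\binom{n-1}{2}$ of the turning points $w = u \oplus(\lambda\odot v)$, $\lambda\in\Lambda(u,v)$, have an intermediate tree in which exactly one internal vertex has three children and all other internal vertices have two children, and no turning point has an intermediate tree with an internal vertex having four children.
   Context: Tropical max-plus arithmetic: $a \oplus b = \max(a,b)$, $a \odot b = a + b$, applied coordinatewise; $\lambda \odot u = u + \lambda\mathbb{1}$ with $\mathbb{1}$ the all-ones vector. An ultrametric $u\in\mathbb{R}^{\binom n2}$ (for all distinct $i,j,k$ the maximum of $u_{ij},u_{ik},u_{jk}$ is attained at least twice), considered modulo $\mathbb{R}\mathbb{1}$, is the vector of leaf-to-leaf distances $u_{ij}=d_T(i,j)$ of an equidistant tree $T$ (rooted metric tree with leaves labelled by $[n]$, positive internal edge lengths, all leaves equidistant from the root). The maximum $u\oplus v$ of two ultrametrics is an ultrametric. The tropical line segment between $u$ and $v$ is $\{\lambda \odot u \oplus \mu \odot v : \lambda,\mu\in\mathbb{R}\}$ modulo $\mathbb{R}\mathbb{1}$, the concatenation of Euclidean segments between consecutive turning points $u\oplus(\lambda\odot v)$, $\lambda$ running in increasing order through the set of turning point scalars $\Lambda(u,v) = \{u_{ij}-v_{ij}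 : i<j\}$. The intermediate tree at a turning point $w$ is the equidistant tree with ultrametric $w$. A single NNI (nearest neighbor interchange) occurs at a turning point whose intermediate tree has exactly one internal vertex with three children and all others with two; a four clade rearrangement occurs at a turning point whose intermediate tree has an internal vertex with four children. -}

module Defs where

open import Data.Nat as ℕ using (ℕ; suc; _∸_; _≤_) renaming (_*_ to _*ℕ_; _⊓_ to _⊓ℕ_; _⊔_ to _⊔ℕ_)
open import Data.Integer as ℤ using (ℤ; +_; _-_; _+_; _⊔_; 0ℤ) renaming (_<_ to _<ℤ_)
open import Data.Fin using (Fin; toℕ)
open import Data.List using (List; []; _∷_; length; filter; _++_)
open import Data.List.Relation.Unary.All using (All)
open import Data.List.Membership.Propositional using (_∈_)
open import Data.Product using (Σ; _×_; ∃)
open import Data.Sum using (_⊎_)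
open import Data.Unit using (⊤)
open import Relation.Nullary using (¬_)
open import Relation.Binary.PropositionalEquality using (_≡_)

-- Leaves are labelled by Fin n; label i : Fin n stands for i+1 ∈ [n].

u : (n : ℕ) → Fin n → Fin n → ℤ
u n i j = + (n *ℕ (n ∸ suc (toℕ i ⊓ℕ toℕ j)))

v : (n : ℕ) → Fin n → Fin n → ℤ
v n i j = + (toℕ i ⊔ℕ toℕ j)

InΛ : (n : ℕ) → ℤ → Set
InΛ n l = Σ (Fin n) λ i → Σ (Fin n) λ j → (toℕ i ℕ.< toℕ j) × (l ≡ u n i j - v n i j)

turn : (n : ℕ) → ℤ → Fin n → Fin n → ℤ
turn n l i j = u n i j ⊔ (l + v n i j)

-- Every vertex carries the value  2·(its distance to the leaves):
-- leaves carry 0, an internal vertex `node d ts` carries d.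
-- Then the leaf-to-leaf distance d_T(i,j) is the value d of the lowest
-- common ancestor of i and j; all leaves are equidistant from the root
-- by construction.

data Tree (n : ℕ) : Set where
  leaf : Fin n → Tree n
  node : ℤ → List (Tree n) → Tree n

hgt : ∀ {n} → Tree n → ℤ
hgt (leaf _)   = 0ℤ
hgt (node d _) = d

mutual
  leaves : ∀ {n} → Tree n → List (Fin n)
  leaves (leaf i)    = i ∷ []
  leaves (node _ ts) = leavesL ts

  leavesL : ∀ {n} → List (Tree n) → List (Fin n)
  leavesL []       = []
  leavesL (t ∷ ts) = leaves t ++ leavesL ts

mutual
  arities : ∀ {n} → Tree n → List ℕ
  arities (leaf _)    = []
  arities (node _ ts) = length ts ∷ aritiesL ts

  aritiesL : ∀ {n} → List (Tree n) → List ℕ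
  aritiesL []       = []
  aritiesL (t ∷ ts) = arities t ++ aritiesL ts

mutual
  Valid : ∀ {n} → Tree n → Set
  Valid (leaf _)    = ⊤
  Valid (node d ts) = (2 ≤ length ts) × All (λ t → hgt t <ℤ d) ts × ValidL ts

  ValidL : ∀ {n} → List (Tree n) → Set
  ValidL []       = ⊤
  ValidL (t ∷ ts) = Valid t × ValidL ts

open import Data.List.Relation.Binary.Permutation.Propositional using (_↭_)
open import Data.List using (allFin)

EquidistantTree : (n : ℕ) → Tree n → Set
EquidistantTree n T = Valid T × (leaves T ↭ allFin n)

data LCA {n : ℕ} : Tree n → Fin n → Fin n → ℤ → Set where
  here  : ∀ {d ts i j} → i ∈ leavesL ts → j ∈ leavesL ts →
          All (λ t → ¬ (i ∈ leaves t × j ∈ leaves t)) ts →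
          LCA (node d ts) i j d
  there : ∀ {d d' t ts i j} → t ∈ ts → LCA t i j d' → LCA (node d ts) i j d'

-- T has ultrametric w modulo ℝ𝟙 (shift c taken integral; w is integral here)
Realizes : ∀ {n} → Tree n → (Fin n → Fin n → ℤ) → Set
Realizes {n} T w = ∃ λ (c : ℤ) → ∀ (i j : Fin n) → toℕ i ℕ.< toℕ j → LCA T i j (w i j + c)

IntermediateTree : (n : ℕ) → ℤ → Tree n → Set
IntermediateTree n l T = EquidistantTree n T × Realizes T (turn n l)

open import Data.Nat using (_≟_)

SingleNNI : ∀ {n} → Tree n → Set
SingleNNI T = All (λ k → k ≡ 2 ⊎ k ≡ 3) (arities T)
            × length (filter (_≟ 3) (arities T)) ≡ 1

FourClade : ∀ {n} → Tree n → Set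
FourClade T = 4 ∈ arities T

-- Index leaves from 0 and let a < b be the pair whose turning point is considered, λ = u_ab − v_ab.
-- With U x = n (n − 1 − x) and V y = λ + y, the turning point has coordinates
-- W x y = max (U (min x y)) (V (max x y)), and its tree can be written down: a left comb on
-- 0, …, a−1 at heights U, above a right comb on b+1, …, n−1 at heights V, above one vertex with
-- children a, (a right comb on a+1, …, b−1) and b at height V b = U a. That vertex is ternary iff
-- a + 1 < b, which gives the C(n−1, 2) single NNIs. Conversely the leaves below distinct children of
-- a vertex have pairwise equal W; for a sorted triple p < q < r the growth of U and V forces p = a and
-- r = b, so a ternary vertex needs a + 1 < b and a vertex with four children cannot exist. Distinct
-- pairs give distinct λ since λ lies in the window (U a − n, U a), and these windows are disjoint.

module Submission where

open import Defs
open import Data.Empty using (⊥-elim)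
open import Data.Fin using (Fin; toℕ)
open import Data.Fin.Properties using (toℕ<n; toℕ-injective; toℕ-fromℕ<)
open import Data.Integer as ℤ using (ℤ; +_; -_; _-_; 0ℤ; +<+; +≤+)
import Data.Integer.Properties as ℤ
open import Data.List using (List; []; _∷_; _++_; length; map; filter; replicate; upTo; allFin)
open import Data.List.Membership.Propositional using (_∈_; _∉_)
open import Data.List.Membership.Propositional.Properties
  using (∈-++⁺ˡ; ∈-++⁺ʳ; ∈-++⁻; ∈-map⁺; ∈-map⁻; ∈-filter⁻; ∈-allFin; ∈-upTo⁺; ∈-upTo⁻)
open import Data.List.Membership.Propositional.Properties.WithK using (unique∧set⇒bag)
open import Data.List.Properties using (++-identityʳ; length-++; length-map; length-upTo; filter-none)
open import Data.List.Relation.Binary.BagAndSetEquality using (∼bag⇒↭)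
open import Data.List.Relation.Binary.Disjoint.Propositional using (Disjoint)
open import Data.List.Relation.Binary.Permutation.Propositional using (_↭_; ↭-sym; ↭⇒↭ₛ)
open import Data.List.Relation.Binary.Permutation.Propositional.Properties using (All-resp-↭; ↭-length)
open import Data.List.Relation.Binary.Permutation.Setoid.Properties using (AllPairs-resp-↭; Unique-resp-↭)
open import Data.List.Relation.Unary.All as All using (All; []; _∷_)
import Data.List.Relation.Unary.All.Properties as All
open import Data.List.Relation.Unary.AllPairs as AllPairs using (AllPairs; []; _∷_)
import Data.List.Relation.Unary.AllPairs.Properties as AllPairs
open import Data.List.Relation.Unary.Any using (here; there)
open import Data.List.Relation.Unary.Linked using (Linked; []; [-]; _∷_)
open import Data.List.Relation.Unary.Unique.Propositional using (Unique)
import Data.List.Relation.Unary.Unique.Propositional.Properties as Unique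
open import Data.Nat using (ℕ; zero; suc; _+_; _*_; _∸_; _⊓_; _⊔_; _≤_; _<_; s≤s; z≤n; _≟_; _<?_; _≤?_)
open import Data.Nat.Combinatorics using (_C_; nC1≡n; nCk+nC[k+1]≡[n+1]C[k+1])
open import Data.Nat.DivMod using (_mod_; m<n⇒m%n≡m)
open import Data.Nat.Properties
open import Data.List.Sort ≤-decTotalOrder using (sort; sort-↭; sort-↗)
open import Data.Product using (Σ; ∃; ∃₂; _×_; _,_; proj₁; proj₂)
open import Data.Sum using (_⊎_; inj₁; inj₂)
open import Data.Unit using (tt)
open import Function using (_∘_)
open import Function.Bundles using (_⇔_; mk⇔; module Equivalence)
open import Relation.Binary.Definitions using (tri<; tri≈; tri>)
open import Relation.Binary.PropositionalEquality
  using (_≡_; _≢_; refl; sym; trans; cong; cong₂; subst; subst₂; setoid; resp₂; module ≡-Reasoning)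
open import Relation.Nullary using (¬_; yes; no)

open Equivalence using (to; from)

module _ {A : Set} where

  Unique-++⁻ : ∀ (xs : List A) {ys} → Unique (xs ++ ys) → Unique xs × Unique ys × Disjoint xs ys
  Unique-++⁻ [] u = [] , u , λ ()
  Unique-++⁻ (x ∷ xs) (x∉ ∷ u) with Unique-++⁻ xs u
  ... | uxs , uys , disj = All.++⁻ˡ xs x∉ ∷ uxs , uys , disj′
    where
      disj′ : Disjoint (x ∷ xs) _
      disj′ (here refl , q) = All.lookup (All.++⁻ʳ xs x∉) q refl
      disj′ (there p , q) = disj (p , q)

module _ {n : ℕ} where

  ∈-leavesL⁺ : ∀ {t : Tree n} {ts x} → t ∈ ts → x ∈ leaves t → x ∈ leavesL ts
  ∈-leavesL⁺ {ts = _ ∷ _} (here refl) p = ∈-++⁺ˡ p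
  ∈-leavesL⁺ {ts = t ∷ _} (there q) p = ∈-++⁺ʳ (leaves t) (∈-leavesL⁺ q p)

  ∈-leavesL⁻ : ∀ {ts : List (Tree n)} {x} → x ∈ leavesL ts → ∃ λ t → t ∈ ts × x ∈ leaves t
  ∈-leavesL⁻ {t ∷ ts} p with ∈-++⁻ (leaves t) p
  ... | inj₁ q = t , here refl , q
  ... | inj₂ q with ∈-leavesL⁻ q
  ...   | t′ , m , r = t′ , there m , r

  Unique-child : ∀ {ts : List (Tree n)} {t} → Unique (leavesL ts) → t ∈ ts → Unique (leaves t)
  Unique-child {t ∷ _} u m with Unique-++⁻ (leaves t) u | m
  ... | u-t , _ , _ | here refl = u-t
  ... | _ , u′ , _ | there m = Unique-child u′ m

  Valid-child : ∀ {ts : List (Tree n)} {t} → ValidL ts → t ∈ ts → Valid t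
  Valid-child (v , _) (here refl) = v
  Valid-child (_ , vs) (there m) = Valid-child vs m

  child-unique : ∀ {ts : List (Tree n)} {t t′ x} → Unique (leavesL ts) → t ∈ ts → t′ ∈ ts →
                 x ∈ leaves t → x ∈ leaves t′ → t ≡ t′
  child-unique {s ∷ _} u m m′ p q with Unique-++⁻ (leaves s) u | m | m′
  ... | _ , _ , _ | here refl | here refl = refl
  ... | _ , _ , disj | here refl | there m′ = ⊥-elim (disj (p , ∈-leavesL⁺ m′ q))
  ... | _ , _ , disj | there m | here refl = ⊥-elim (disj (q , ∈-leavesL⁺ m p))
  ... | _ , u′ , _ | there m | there m′ = child-unique u′ m m′ p q

  LCA⇒∈leaves : ∀ {t : Tree n} {x y d} → LCA t x y d → x ∈ leaves t × y ∈ leaves t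
  LCA⇒∈leaves (here p q _) = p , q
  LCA⇒∈leaves (there m l) with LCA⇒∈leaves l
  ... | x∈t , y∈t = ∈-leavesL⁺ m x∈t , ∈-leavesL⁺ m y∈t

  LCA-sym : ∀ {t : Tree n} {x y d} → LCA t x y d → LCA t y x d
  LCA-sym (here p q sep) = here q p (All.map (λ ¬both (p , q) → ¬both (q , p)) sep)
  LCA-sym (there m l) = there m (LCA-sym l)

  LCA-functional : ∀ {t : Tree n} {x y d d′} → Unique (leaves t) → LCA t x y d → LCA t x y d′ → d ≡ d′
  LCA-functional u (here _ _ _) (here _ _ _) = refl
  LCA-functional u (here _ _ sep) (there m l) = ⊥-elim (All.lookup sep m (LCA⇒∈leaves l))
  LCA-functional u (there m l) (here _ _ sep) = ⊥-elim (All.lookup sep m (LCA⇒∈leaves l))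
  LCA-functional u (there m l) (there m′ l′)
    with refl ← child-unique u m′ m (proj₁ (LCA⇒∈leaves l′)) (proj₁ (LCA⇒∈leaves l))
    = LCA-functional (Unique-child u m) l l′

  LCA-node : ∀ {ts : List (Tree n)} {t x y} (d : ℤ) → Unique (leavesL ts) → t ∈ ts →
             x ∈ leaves t → y ∉ leaves t → y ∈ leavesL ts → LCA (node d ts) x y d
  LCA-node d u m x∈t y∉t y∈ts = here (∈-leavesL⁺ m x∈t) y∈ts
    (All.tabulate λ m′ (x∈t′ , y∈t′) →
      y∉t (subst (λ s → _ ∈ leaves s) (child-unique u m′ m x∈t′ x∈t) y∈t′))

  infix 4 _⊑_
  data _⊑_ (s : Tree n) : Tree n → Set where
    ⊑-refl : s ⊑ s
    ⊑-child : ∀ {d ts t} → t ∈ ts → s ⊑ t → s ⊑ node d ts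

  LCA-⊑ : ∀ {s t x y d} → s ⊑ t → LCA s x y d → LCA t x y d
  LCA-⊑ ⊑-refl l = l
  LCA-⊑ (⊑-child m s⊑t) l = there m (LCA-⊑ s⊑t l)

  Unique-⊑ : ∀ {s t} → s ⊑ t → Unique (leaves t) → Unique (leaves s)
  Unique-⊑ ⊑-refl u = u
  Unique-⊑ (⊑-child m s⊑t) u = Unique-⊑ s⊑t (Unique-child u m)

  Valid-⊑ : ∀ {s t} → s ⊑ t → Valid t → Valid s
  Valid-⊑ ⊑-refl v = v
  Valid-⊑ (⊑-child m s⊑t) (_ , _ , vs) = Valid-⊑ s⊑t (Valid-child vs m)

  mutual
    arity⇒⊑ : ∀ {k} (t : Tree n) → k ∈ arities t → ∃₂ λ d ts → node d ts ⊑ t × length ts ≡ k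
    arity⇒⊑ (node d ts) (here refl) = d , ts , ⊑-refl , refl
    arity⇒⊑ (node d ts) (there p) with arity⇒⊑L ts p
    ... | t , m , d′ , ts′ , s⊑t , len = d′ , ts′ , ⊑-child m s⊑t , len

    arity⇒⊑L : ∀ {k} (ts : List (Tree n)) → k ∈ aritiesL ts →
               ∃ λ t → t ∈ ts × ∃₂ λ d ts′ → node d ts′ ⊑ t × length ts′ ≡ k
    arity⇒⊑L (t ∷ ts) p with ∈-++⁻ (arities t) p
    ... | inj₁ q = t , here refl , arity⇒⊑ t q
    ... | inj₂ q with arity⇒⊑L ts q
    ...   | t′ , m , r = t′ , there m , r

  Valid⇒leaf : ∀ {t : Tree n} → Valid t → ∃ λ x → x ∈ leaves t
  Valid⇒leaf {leaf x} _ = x , here refl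
  Valid⇒leaf {node d (t ∷ _)} (_ , _ , vt , _) with Valid⇒leaf {t} vt
  ... | x , p = x , ∈-++⁺ˡ p

  0≤hgt : ∀ {t : Tree n} → Valid t → 0ℤ ℤ.≤ hgt t
  0≤hgt {leaf _} _ = ℤ.≤-refl
  0≤hgt {node d (t ∷ _)} (_ , t<d ∷ _ , vt , _) = ℤ.<⇒≤ (ℤ.≤-<-trans (0≤hgt vt) t<d)

  Apart : List (Tree n) → Fin n → Fin n → Set
  Apart ts x y = x ∈ leavesL ts × y ∈ leavesL ts × All (λ t → ¬ (x ∈ leaves t × y ∈ leaves t)) ts

  Apart⇒≢ : ∀ {ts x y} → Apart ts x y → x ≢ y
  Apart⇒≢ (x∈ts , _ , sep) refl with ∈-leavesL⁻ x∈ts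
  ... | t , m , x∈t = All.lookup sep m (x∈t , x∈t)

  Apart⇒LCA : ∀ {d ts x y} → Apart ts x y → LCA (node d ts) x y d
  Apart⇒LCA (x∈ts , y∈ts , sep) = here x∈ts y∈ts sep

  children-representatives : ∀ {ts : List (Tree n)} → ValidL ts → Unique (leavesL ts) →
    ∃ λ xs → length xs ≡ length ts × AllPairs (Apart ts) xs × All (_∈ leavesL ts) xs
  children-representatives {[]} _ _ = [] , refl , [] , []
  children-representatives {t ∷ ts} (vt , vts) u
    with Unique-++⁻ (leaves t) u | Valid⇒leaf vt
  ... | _ , uts , disj | x , x∈t with children-representatives vts uts
  ...   | xs , len , apart , mem =
    x ∷ xs , cong suc len , All.map apart-x mem ∷ AllPairs.map apart-tail apart ,
    ∈-++⁺ˡ x∈t ∷ All.map (∈-++⁺ʳ (leaves t)) mem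
    where
      apart-x : ∀ {y} → y ∈ leavesL ts → Apart (t ∷ ts) x y
      apart-x y∈ts = ∈-++⁺ˡ x∈t , ∈-++⁺ʳ (leaves t) y∈ts ,
        (λ (_ , y∈t) → disj (y∈t , y∈ts)) ∷
        All.tabulate λ m (x∈t′ , _) → disj (x∈t , ∈-leavesL⁺ m x∈t′)
      apart-tail : ∀ {y z} → Apart ts y z → Apart (t ∷ ts) y z
      apart-tail (y∈ts , z∈ts , sep) = ∈-++⁺ʳ (leaves t) y∈ts , ∈-++⁺ʳ (leaves t) z∈ts ,
        (λ (y∈t , _) → disj (y∈t , y∈ts)) ∷ sep

  wide-node⇒separated-leaves : ∀ {t : Tree n} {k} → Valid t → Unique (leaves t) → k ∈ arities t →
    ∃₂ λ d xs → length xs ≡ k × AllPairs (λ x y → x ≢ y × LCA t x y d) xs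
  wide-node⇒separated-leaves {t} v u k∈t with arity⇒⊑ t k∈t
  ... | d , ts , s⊑t , len with Valid-⊑ s⊑t v | Unique-⊑ s⊑t u
  ...   | _ , _ , vts | us with children-representatives vts us
  ...     | xs , len′ , apart , _ =
    d , xs , trans len′ len ,
    AllPairs.map (λ apart → Apart⇒≢ apart , LCA-⊑ s⊑t (Apart⇒LCA apart)) apart

  EquidistantTree⇒Unique : ∀ {t} → EquidistantTree n t → Unique (leaves t)
  EquidistantTree⇒Unique (_ , leaves↭) =
    Unique-resp-↭ (setoid (Fin n)) (↭⇒↭ₛ (↭-sym leaves↭)) (Unique.allFin⁺ n)

  Interval : List (Fin n) → ℕ → ℕ → Set
  Interval xs lo hi = Unique xs × (∀ {x} → x ∈ xs ⇔ (lo ≤ toℕ x × toℕ x < hi))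

  Interval-[] : ∀ lo → Interval [] lo lo
  Interval-[] lo = [] , mk⇔ (λ ()) (λ (lo≤x , x<lo) → ⊥-elim (<-irrefl refl (<-≤-trans x<lo lo≤x)))

  Interval-[_] : ∀ x → Interval (x ∷ []) (toℕ x) (suc (toℕ x))
  Interval-[ x ] = All.[] ∷ [] , mk⇔ (λ { (here refl) → ≤-refl , n<1+n _ })
    (λ (x≤y , y≤x) → here (toℕ-injective (≤-antisym (≤-pred y≤x) x≤y)))

  Interval-++ : ∀ {xs ys lo mid hi} → lo ≤ mid → mid ≤ hi →
                Interval xs lo mid → Interval ys mid hi → Interval (xs ++ ys) lo hi
  Interval-++ {xs} {ys} {mid = mid} lo≤mid mid≤hi (uxs , ∈xs) (uys , ∈ys) =
    Unique.++⁺ uxs uys (λ (p , q) → <-irrefl refl (<-≤-trans (proj₂ (to ∈xs p)) (proj₁ (to ∈ys q)))) ,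
    mk⇔ bounded member
    where
      bounded : ∀ {x} → x ∈ xs ++ ys → _
      bounded p with ∈-++⁻ xs p
      ... | inj₁ q = proj₁ (to ∈xs q) , <-≤-trans (proj₂ (to ∈xs q)) mid≤hi
      ... | inj₂ q = ≤-trans lo≤mid (proj₁ (to ∈ys q)) , proj₂ (to ∈ys q)
      member : ∀ {x} → _ → x ∈ xs ++ ys
      member {x} (lo≤x , x<hi) with <-cmp (toℕ x) mid
      ... | tri< x<mid _ _ = ∈-++⁺ˡ (from ∈xs (lo≤x , x<mid))
      ... | tri≈ _ x≡mid _ = ∈-++⁺ʳ xs (from ∈ys (≤-reflexive (sym x≡mid) , x<hi))
      ... | tri> _ _ mid<x = ∈-++⁺ʳ xs (from ∈ys (<⇒≤ mid<x , x<hi))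

  Interval⇒↭allFin : ∀ {xs} → Interval xs 0 n → xs ↭ allFin n
  Interval⇒↭allFin (uxs , ∈xs) = ∼bag⇒↭ (unique∧set⇒bag uxs (Unique.allFin⁺ n)
    (λ {x} → mk⇔ (λ _ → ∈-allFin x) (λ _ → from ∈xs (z≤n , toℕ<n x))))

U : ℕ → ℕ → ℕ
U n x = n * (n ∸ suc x)

scalar : ℕ → ℕ → ℕ → ℕ
scalar n a b = U n a ∸ b

n+U≤U : ∀ {n x y} → x < y → y < n → n + U n y ≤ U n x
n+U≤U {n} {x} {y} x<y y<n = begin
  n + U n y                ≡⟨ *-suc n (n ∸ suc y) ⟨
  n * suc (n ∸ suc y)      ≡⟨ cong (n *_) (+-∸-assoc 1 y<n) ⟨
  n * (n ∸ y)              ≤⟨ *-monoʳ-≤ n (∸-monoʳ-≤ n x<y) ⟩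
  U n x                    ∎
  where open ≤-Reasoning

n≤U : ∀ {n x y} → x < y → y < n → n ≤ U n x
n≤U {n} x<y y<n = ≤-trans (m≤m+n n _) (n+U≤U x<y y<n)

b≤U : ∀ {n a b} → a < b → b < n → b ≤ U n a
b≤U a<b b<n = ≤-trans (<⇒≤ b<n) (n≤U a<b b<n)

U-antitone : ∀ {n x y} → x ≤ y → U n y ≤ U n x
U-antitone {n} x≤y = *-monoʳ-≤ n (∸-monoʳ-≤ n (s≤s x≤y))

U-decreasing : ∀ {n x y} → x < y → y < n → U n y < U n x
U-decreasing {n} {x} {y} x<y y<n = <-≤-trans (m<n+m (U n y) (≤-<-trans z≤n y<n)) (n+U≤U x<y y<n)

scalar-< : ∀ {n a b a′ b′} → a′ < a → a < n → a′ < b′ → b′ < n → scalar n a b < scalar n a′ b′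
scalar-< {n} {a} {b} {a′} {b′} a′<a a<n a′<b′ b′<n = begin-strict
  U n a ∸ b      ≤⟨ m∸n≤m (U n a) b ⟩
  U n a          ≤⟨ m+n≤o⇒m≤o∸n (U n a) (subst (_≤ U n a′) (+-comm n (U n a)) (n+U≤U a′<a a<n)) ⟩
  U n a′ ∸ n     <⟨ ∸-monoʳ-< b′<n (n≤U a′<b′ b′<n) ⟩
  U n a′ ∸ b′    ∎
  where open ≤-Reasoning

scalar-injective : ∀ {n a b a′ b′} → a < b → b < n → a′ < b′ → b′ < n →
                   scalar n a b ≡ scalar n a′ b′ → a ≡ a′ × b ≡ b′
scalar-injective {n} {a} {b} {a′} {b′} a<b b<n a′<b′ b′<n eq with <-cmp a a′
... | tri< a<a′ _ _ =
  ⊥-elim (<-irrefl (sym eq) (scalar-< {b = b′} {b′ = b} a<a′ (<-trans a′<b′ b′<n) a<b b<n))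
... | tri> _ _ a′<a =
  ⊥-elim (<-irrefl eq (scalar-< {b = b} {b′ = b′} a′<a (<-trans a<b b<n) a′<b′ b′<n))
... | tri≈ _ refl _ = refl , ∸-cancelˡ-≡ (b≤U a<b b<n) (b≤U a′<b′ b′<n) eq

Λ≡scalar : ∀ {n} {i j : Fin n} → toℕ i < toℕ j → u n i j - v n i j ≡ + scalar n (toℕ i) (toℕ j)
Λ≡scalar {n} {i} {j} i<j rewrite m≤n⇒m⊓n≡m (<⇒≤ i<j) | m≤n⇒m⊔n≡n (<⇒≤ i<j) =
  trans (ℤ.[+m]-[+n]≡m⊖n (U n (toℕ i)) (toℕ j)) (ℤ.⊖-≥ (b≤U i<j (toℕ<n j)))

module TurningPoint (n a b : ℕ) (a<b : a < b) (b<n : b < n) where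

  V : ℕ → ℕ
  V y = scalar n a b + y

  W : ℕ → ℕ → ℕ
  W x y = U n (x ⊓ y) ⊔ V (x ⊔ y)

  V-b : V b ≡ U n a
  V-b = m∸n+n≡m (b≤U a<b b<n)

  V-injective : ∀ {x y} → V x ≡ V y → x ≡ y
  V-injective = +-cancelˡ-≡ (scalar n a b) _ _

  V<n+U-a : ∀ {y} → y < n → V y < n + U n a
  V<n+U-a {y} y<n = begin-strict
    scalar n a b + y  ≤⟨ +-monoˡ-≤ y (m∸n≤m (U n a) b) ⟩
    U n a + y         <⟨ +-monoʳ-< (U n a) y<n ⟩
    U n a + n         ≡⟨ +-comm (U n a) n ⟩
    n + U n a         ∎
    where open ≤-Reasoning

  W-comm : ∀ x y → W x y ≡ W y x
  W-comm x y = cong₂ (λ p q → U n p ⊔ V q) (⊓-comm x y) (⊔-comm x y)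

  W-≤ : ∀ {x y} → x ≤ y → W x y ≡ U n x ⊔ V y
  W-≤ x≤y rewrite m≤n⇒m⊓n≡m x≤y | m≤n⇒m⊔n≡n x≤y = refl

  W-left : ∀ {x y} → x < a → x ≤ y → y < n → W x y ≡ U n x
  W-left x<a x≤y y<n = trans (W-≤ x≤y)
    (m≥n⇒m⊔n≡m (<⇒≤ (<-≤-trans (V<n+U-a y<n) (n+U≤U x<a (<-trans a<b b<n)))))

  W-a : ∀ {y} → a ≤ y → W a y ≡ V (b ⊔ y)
  W-a {y} a≤y = begin
    W a y        ≡⟨ W-≤ a≤y ⟩
    U n a ⊔ V y  ≡⟨ cong (_⊔ V y) V-b ⟨
    V b ⊔ V y    ≡⟨ +-distribˡ-⊔ (scalar n a b) b y ⟨
    V (b ⊔ y)    ∎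
    where open ≡-Reasoning

  W-right : ∀ {x y} → a < x → x ≤ y → y < n → W x y ≡ V y
  W-right {x} {y} a<x x≤y y<n = trans (W-≤ x≤y) (m≤n⇒m⊔n≡n (begin
    U n x         ≤⟨ m+n≤o⇒m≤o∸n (U n x) (subst (_≤ U n a) (+-comm n (U n x)) (n+U≤U a<x x<n)) ⟩
    U n a ∸ n     ≤⟨ ∸-monoʳ-≤ (U n a) (<⇒≤ b<n) ⟩
    scalar n a b  ≤⟨ m≤m+n (scalar n a b) y ⟩
    V y           ∎))
    where
      open ≤-Reasoning
      x<n = ≤-<-trans x≤y y<n

  V-increasing : ∀ {x y} → x < y → V x < V y
  V-increasing = +-monoʳ-< (scalar n a b)

  W-beyond-a : ∀ {x y} → a ≤ x → x < y → b ≤ y → y < n → W x y ≡ V y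
  W-beyond-a {x} {y} a≤x x<y b≤y y<n with m≤n⇒m<n∨m≡n a≤x
  ... | inj₁ a<x = W-right a<x (<⇒≤ x<y) y<n
  ... | inj₂ refl = trans (W-a (<⇒≤ x<y)) (cong V (m≤n⇒m⊔n≡n b≤y))

  W<U-left : ∀ {p q r} → p < a → p < q → q ≤ r → r < n → W q r < U n p
  W<U-left {p} {q} {r} p<a p<q q≤r r<n with q <? a
  ... | yes q<a = subst (_< U n p) (sym (W-left q<a q≤r r<n)) (U-decreasing p<q (<-trans q<a (<-trans a<b b<n)))
  ... | no q≮a = <-≤-trans (subst (_< n + U n a) (sym (W-≤ q≤r)) (⊔-lub U-q<n+U-a (V<n+U-a r<n)))
                            (n+U≤U p<a (<-trans a<b b<n))
    where
      U-q<n+U-a : U n q < n + U n a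
      U-q<n+U-a = ≤-<-trans (U-antitone {n} (≮⇒≥ q≮a)) (m<n+m (U n a) (≤-<-trans z≤n b<n))

  -- p < a makes W p q = U p larger than W q r; p > a makes W p q = V q ≠ V r = W p r;
  -- so p = a, and then V (b ⊔ q) = W a q = W q r = V r forces r = b.
  equilateral-triple : ∀ {p q r} → p < q → q < r → r < n →
                       W p q ≡ W p r → W p q ≡ W q r → p ≡ a × r ≡ b
  equilateral-triple {p} {q} {r} p<q q<r r<n pq≡pr pq≡qr with <-cmp p a
  ... | tri< p<a _ _ =
    ⊥-elim (<-irrefl (trans (sym pq≡qr) (W-left p<a (<⇒≤ p<q) q<n)) (W<U-left p<a p<q (<⇒≤ q<r) r<n))
    where q<n = <-trans q<r r<n
  ... | tri> _ _ a<p =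
    ⊥-elim (<-irrefl (V-injective (trans (sym (W-right a<p (<⇒≤ p<q) (<-trans q<r r<n)))
                                 (trans pq≡pr (W-right a<p (<⇒≤ (<-trans p<q q<r)) r<n)))) q<r)
  ... | tri≈ _ refl _ = refl , r≡b
    where
      b⊔q≡r : b ⊔ q ≡ r
      b⊔q≡r = V-injective (trans (sym (W-a (<⇒≤ p<q))) (trans pq≡qr (W-right p<q (<⇒≤ q<r) r<n)))
      r≡b : r ≡ b
      r≡b with ⊔-sel b q
      ... | inj₁ b⊔q≡b = trans (sym b⊔q≡r) b⊔q≡b
      ... | inj₂ b⊔q≡q = ⊥-elim (<-irrefl (trans (sym b⊔q≡q) b⊔q≡r) q<r)

  Equilateral : ℤ → List ℕ → Set
  Equilateral e = AllPairs (λ p q → p ≢ q × + W p q ≡ e)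

  sort-equilateral : ∀ {e ps} → All (_< n) ps → Equilateral e ps →
    ∃ λ qs → length qs ≡ length ps × Linked _<_ qs × All (_< n) qs × Equilateral e qs
  sort-equilateral {e} {ps} ps<n eq-ps =
    sort ps , ↭-length (sort-↭ ps) , strictly (sort-↗ ps) eq-qs , All-resp-↭ (↭-sym (sort-↭ ps)) ps<n , eq-qs
    where
      eq-qs : Equilateral e (sort ps)
      eq-qs = AllPairs-resp-↭ (setoid ℕ) (λ (p≢q , e≡) → p≢q ∘ sym , trans (cong +_ (W-comm _ _)) e≡)
                (resp₂ _) (↭⇒↭ₛ (↭-sym (sort-↭ ps))) eq-ps
      strictly : ∀ {qs} → Linked _≤_ qs → Equilateral e qs → Linked _<_ qs
      strictly [] _ = []
      strictly [-] _ = [-]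
      strictly (p≤q ∷ sorted) (((p≢q , _) ∷ _) ∷ eq) = ≤∧≢⇒< p≤q p≢q ∷ strictly sorted eq

  equilateral-sorted-triple : ∀ {e p q r} → p < q → q < r → r < n →
    Equilateral e (p ∷ q ∷ r ∷ []) → p ≡ a × r ≡ b
  equilateral-sorted-triple p<q q<r r<n (((_ , pq) ∷ (_ , pr) ∷ []) ∷ ((_ , qr) ∷ []) ∷ [] ∷ []) =
    equilateral-triple p<q q<r r<n (ℤ.+-injective (trans pq (sym pr))) (ℤ.+-injective (trans pq (sym qr)))

  sorted-equilateral-length≢4 : ∀ {e} qs → Linked _<_ qs → All (_< n) qs → Equilateral e qs →
                                length qs ≢ 4
  sorted-equilateral-length≢4 (p ∷ q ∷ r ∷ s ∷ []) (p<q ∷ q<r ∷ r<s ∷ [-]) (_ ∷ _ ∷ r<n ∷ s<n ∷ [])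
    ((pq ∷ pr ∷ ps ∷ []) ∷ (qr ∷ qs ∷ []) ∷ (rs ∷ []) ∷ [] ∷ []) refl
    with equilateral-sorted-triple p<q q<r r<n ((pq ∷ pr ∷ []) ∷ (qr ∷ []) ∷ [] ∷ [])
       | equilateral-sorted-triple p<q (<-trans q<r r<s) s<n ((pq ∷ ps ∷ []) ∷ (qs ∷ []) ∷ [] ∷ [])
  ... | _ , r≡b | _ , s≡b = <-irrefl (trans r≡b (sym s≡b)) r<s

  sorted-equilateral-length3⇒gap : ∀ {e} qs → Linked _<_ qs → All (_< n) qs → Equilateral e qs →
                                   length qs ≡ 3 → suc a < b
  sorted-equilateral-length3⇒gap (p ∷ q ∷ r ∷ []) (p<q ∷ q<r ∷ [-]) (_ ∷ _ ∷ r<n ∷ []) eq refl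
    with refl , refl ← equilateral-sorted-triple p<q q<r r<n eq = <-≤-trans (s≤s p<q) q<r

  equilateral-length≢4 : ∀ {e ps} → All (_< n) ps → Equilateral e ps → length ps ≢ 4
  equilateral-length≢4 ps<n eq-ps len with sort-equilateral ps<n eq-ps
  ... | qs , len-qs , sorted , qs<n , eq-qs =
    sorted-equilateral-length≢4 qs sorted qs<n eq-qs (trans len-qs len)

  equilateral-length3⇒gap : ∀ {e ps} → All (_< n) ps → Equilateral e ps → length ps ≡ 3 → suc a < b
  equilateral-length3⇒gap ps<n eq-ps len with sort-equilateral ps<n eq-ps
  ... | qs , len-qs , sorted , qs<n , eq-qs =
    sorted-equilateral-length3⇒gap qs sorted qs<n eq-qs (trans len-qs len)

count≡1⇒∈ : ∀ k xs → length (filter (_≟ k) xs) ≡ 1 → k ∈ xs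
count≡1⇒∈ k xs count≡1 with filter (_≟ k) xs in eq
... | y ∷ _ with ∈-filter⁻ (_≟ k) (subst (y ∈_) (sym eq) (here refl))
...   | y∈xs , refl = y∈xs

m+n≡o⇒m≡o-n : ∀ {m n o : ℤ} → m ℤ.+ n ≡ o → m ≡ o - n
m+n≡o⇒m≡o-n {m} {n} {o} m+n≡o = begin
  m                  ≡⟨ ℤ.+-identityʳ m ⟨
  m ℤ.+ ℤ.0ℤ         ≡⟨ cong (λ k → m ℤ.+ k) (ℤ.+-inverseʳ n) ⟨
  m ℤ.+ (n - n)      ≡⟨ ℤ.+-assoc m n (- n) ⟨
  m ℤ.+ n - n        ≡⟨ cong (_- n) m+n≡o ⟩
  o - n              ∎
  where open ≡-Reasoning

module IntermediateTreeProperties {n : ℕ} (i j : Fin n) (i<j : toℕ i < toℕ j) (T : Tree n)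
                                  (intermediate : IntermediateTree n (+ scalar n (toℕ i) (toℕ j)) T) where

  open TurningPoint n (toℕ i) (toℕ j) i<j (toℕ<n j)

  shift : ℤ
  shift = proj₁ (proj₂ intermediate)

  -- turn n (+ scalar n a b) x y reduces to + W (toℕ x) (toℕ y).
  realizes : ∀ x y → toℕ x < toℕ y → LCA T x y (+ W (toℕ x) (toℕ y) ℤ.+ shift)
  realizes = proj₂ (proj₂ intermediate)

  unique : Unique (leaves T)
  unique = EquidistantTree⇒Unique (proj₁ intermediate)

  LCA⇒W : ∀ {x y d} → x ≢ y → LCA T x y d → + W (toℕ x) (toℕ y) ≡ d - shift
  LCA⇒W {x} {y} x≢y lca with <-cmp (toℕ x) (toℕ y)
  ... | tri< x<y _ _ = m+n≡o⇒m≡o-n (LCA-functional unique (realizes x y x<y) lca)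
  ... | tri≈ _ x≡y _ = ⊥-elim (x≢y (toℕ-injective x≡y))
  ... | tri> _ _ y<x = trans (cong +_ (W-comm (toℕ x) (toℕ y)))
                         (m+n≡o⇒m≡o-n (LCA-functional unique (realizes y x y<x) (LCA-sym lca)))

  wide-node⇒equilateral : ∀ {k} → k ∈ arities T →
                          ∃₂ λ e ps → length ps ≡ k × All (_< n) ps × Equilateral e ps
  wide-node⇒equilateral k∈T with wide-node⇒separated-leaves (proj₁ (proj₁ intermediate)) unique k∈T
  ... | d , xs , len , separated =
    d - shift , map toℕ xs , trans (length-map toℕ xs) len ,
    All.map⁺ (All.universal toℕ<n xs) ,
    AllPairs.map⁺ (AllPairs.map (λ (x≢y , lca) → x≢y ∘ toℕ-injective , LCA⇒W x≢y lca) separated)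

  no-four-clade : ¬ FourClade T
  no-four-clade 4∈T with wide-node⇒equilateral 4∈T
  ... | _ , _ , len , ps<n , equilateral = equilateral-length≢4 ps<n equilateral len

  single-NNI⇒gap : SingleNNI T → suc (toℕ i) < toℕ j
  single-NNI⇒gap (_ , count≡1) with wide-node⇒equilateral (count≡1⇒∈ 3 (arities T) count≡1)
  ... | _ , _ , len , ps<n , equilateral = equilateral-length3⇒gap ps<n equilateral len

module Combs (m : ℕ) where

  n : ℕ
  n = suc m

  -- Total, but the intended label only for k < n (toℕ-label).
  label : ℕ → Fin n
  label k = k mod n

  toℕ-label : ∀ {k} → k < n → toℕ (label k) ≡ k
  toℕ-label k<n = trans (toℕ-fromℕ< _) (m<n⇒m%n≡m k<n)

  ∈-label : ∀ {k x} → k < n → toℕ x ≡ k → x ∈ leaves (leaf (label k))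
  ∈-label k<n x≡k = here (toℕ-injective (trans x≡k (sym (toℕ-label k<n))))

  Interval-label : ∀ {k} → k < n → Interval (label k ∷ []) k (suc k)
  Interval-label {k} k<n = subst (λ i → Interval (label k ∷ []) i (suc i)) (toℕ-label k<n) Interval-[ label k ]

  rightComb : (ℕ → ℕ) → Tree n → ℕ → ℕ → Tree n
  rightComb h base s zero = base
  rightComb h base s (suc j) = node (+ h (suc s + j)) (rightComb h base s j ∷ leaf (label (suc s + j)) ∷ [])

  module RightComb (h : ℕ → ℕ) (base : Tree n) (lo s : ℕ) (lo≤s : lo ≤ s)
                   (base-interval : Interval (leaves base) lo (suc s)) where

    R : ℕ → Tree n
    R = rightComb h base s

    private
      top≡ : ∀ j → suc s + suc j ≡ suc (suc s + j)
      top≡ j = +-suc (suc s) j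

      top<n : ∀ {j} → s + suc j < n → suc s + j < n
      top<n {j} = subst (_< n) (+-suc s j)

      below<n : ∀ {j} → s + suc j < n → s + j < n
      below<n bound = <-trans (n<1+n _) (top<n bound)

    interval : ∀ j → s + j < n → Interval (leaves (R j)) lo (suc s + j)
    interval zero _ = subst (Interval (leaves base) lo) (cong suc (sym (+-identityʳ s))) base-interval
    interval (suc j) bound = subst (Interval (leaves (R (suc j))) lo) (sym (top≡ j))
      (Interval-++ (≤-trans lo≤s (≤-trans (n≤1+n s) (m≤m+n (suc s) j))) (n≤1+n _)
        (interval j (below<n bound)) (Interval-label (top<n bound)))

    lift : ∀ j {x y d} → LCA base x y d → LCA (R j) x y d
    lift zero lca = lca
    lift (suc j) lca = there (here refl) (lift j lca)

    LCA-R : ∀ j {x y} → s + j < n → lo ≤ toℕ x → toℕ x < toℕ y → s < toℕ y → toℕ y < suc s + j →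
            LCA (R j) x y (+ h (toℕ y))
    LCA-R zero _ _ _ s<y y<top =
      ⊥-elim (<-irrefl refl (<-≤-trans s<y (subst (toℕ _ ≤_) (+-identityʳ s) (≤-pred y<top))))
    LCA-R (suc j) {x} {y} bound lo≤x x<y s<y y<top
      with m≤n⇒m<n∨m≡n (≤-pred (subst (toℕ y <_) (top≡ j) y<top))
    ... | inj₁ y<top′ = there (here refl) (LCA-R j (below<n bound) lo≤x x<y s<y y<top′)
    ... | inj₂ y≡top = subst (λ k → LCA (R (suc j)) x y (+ h k)) (sym y≡top)
        (LCA-node _ (proj₁ (interval (suc j) bound)) (here refl) x∈R y∉R
          (∈-++⁺ʳ (leaves (R j)) (∈-label (top<n bound) y≡top)))
      where
        R-interval = proj₂ (interval j (below<n bound))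
        x∈R : x ∈ leaves (R j)
        x∈R = from R-interval (lo≤x , subst (toℕ x <_) y≡top x<y)
        y∉R : y ∉ leaves (R j)
        y∉R y∈R = <-irrefl y≡top (proj₂ (to R-interval y∈R))

    valid : (∀ {x y} → x < y → h x < h y) → Valid base → hgt base ℤ.≤ + h s →
            ∀ j → Valid (R j) × hgt (R j) ℤ.≤ + h (s + j)
    valid h-mono v-base h-base zero = v-base , subst (λ k → hgt base ℤ.≤ + h k) (sym (+-identityʳ s)) h-base
    valid h-mono v-base h-base (suc j) with valid h-mono v-base h-base j
    ... | v-R , h-R =
      (s≤s (s≤s z≤n) , (ℤ.≤-<-trans h-R (+<+ step) ∷ +<+ (≤-<-trans z≤n step) ∷ []) , v-R , tt , tt) ,
      ℤ.≤-reflexive (cong (λ k → + h k) (sym (+-suc s j)))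
      where step = h-mono (n<1+n (s + j))

    arities-R : ∀ j → arities (R j) ≡ replicate j 2 ++ arities base
    arities-R zero = refl
    arities-R (suc j) = cong (2 ∷_) (trans (++-identityʳ (arities (R j))) (arities-R j))

  leftComb : (ℕ → ℕ) → Tree n → ℕ → ℕ → Tree n
  leftComb h base i zero = base
  leftComb h base i (suc j) = node (+ h i) (leaf (label i) ∷ leftComb h base (suc i) j ∷ [])

  module LeftComb (h : ℕ → ℕ) (base : Tree n) (e hi : ℕ) (e≤hi : e ≤ hi) (hi≤n : hi ≤ n)
                  (base-interval : Interval (leaves base) e hi) where

    L : ℕ → ℕ → Tree n
    L = leftComb h base

    private
      below-top : ∀ {i j} → i + suc j ≡ e → i < e
      below-top {i} i+j≡e = subst (i <_) i+j≡e (m<m+n i (s≤s z≤n))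

      next : ∀ {i j} → i + suc j ≡ e → suc i + j ≡ e
      next {i} {j} i+j≡e = trans (sym (+-suc i j)) i+j≡e

    interval : ∀ j i → i + j ≡ e → Interval (leaves (L i j)) i hi
    interval zero i i+0≡e =
      subst (λ k → Interval (leaves base) k hi) (trans (sym i+0≡e) (+-identityʳ i)) base-interval
    interval (suc j) i i+j≡e =
      Interval-++ (n≤1+n i) i<hi (Interval-label (<-≤-trans i<hi hi≤n))
        (Interval-++ i<hi ≤-refl (interval j (suc i) (next i+j≡e)) (Interval-[] hi))
      where i<hi = <-≤-trans (below-top i+j≡e) e≤hi

    lift : ∀ j i {x y d} → LCA base x y d → LCA (L i j) x y d
    lift zero i lca = lca
    lift (suc j) i lca = there (there (here refl)) (lift j (suc i) lca)

    LCA-L : ∀ j i {x y} → i + j ≡ e → i ≤ toℕ x → toℕ x < e → toℕ x < toℕ y → toℕ y < hi →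
            LCA (L i j) x y (+ h (toℕ x))
    LCA-L zero i i+0≡e i≤x x<e _ _ =
      ⊥-elim (<-irrefl refl (<-≤-trans x<e (subst (_≤ toℕ _) (trans (sym (+-identityʳ i)) i+0≡e) i≤x)))
    LCA-L (suc j) i {x} {y} i+j≡e i≤x x<e x<y y<hi with m≤n⇒m<n∨m≡n i≤x
    ... | inj₁ i<x = there (there (here refl)) (LCA-L j (suc i) (next i+j≡e) i<x x<e x<y y<hi)
    ... | inj₂ i≡x = subst (λ k → LCA (L i (suc j)) x y (+ h k)) i≡x
        (LCA-node _ (proj₁ (interval (suc j) i i+j≡e)) (here refl) (∈-label i<n (sym i≡x)) y∉leaf
          (∈-++⁺ʳ (label i ∷ []) (∈-++⁺ˡ (from (proj₂ (interval j (suc i) (next i+j≡e)))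
            (subst (_< toℕ y) (sym i≡x) x<y , y<hi)))))
      where
        i<n = <-≤-trans (<-≤-trans (below-top i+j≡e) e≤hi) hi≤n
        y∉leaf : ¬ y ∈ leaves (leaf (label i))
        y∉leaf (here refl) = <-irrefl (trans (sym i≡x) (sym (toℕ-label i<n))) x<y

    valid : (∀ {p q} → p < q → q < e → h q < h p) → Valid base → (∀ p → p < e → hgt base ℤ.< + h p) →
            ∀ j i → i + j ≡ e → Valid (L i j) × (∀ p → p < i → hgt (L i j) ℤ.< + h p)
    valid h-dec v-base h-base zero i i+0≡e =
      v-base , λ p p<i → h-base p (subst (p <_) (trans (sym (+-identityʳ i)) i+0≡e) p<i)
    valid h-dec v-base h-base (suc j) i i+j≡e with valid h-dec v-base h-base j (suc i) (next i+j≡e)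
    ... | v-L , below =
      (s≤s (s≤s z≤n) , (ℤ.≤-<-trans (0≤hgt v-L) L<h-i ∷ L<h-i ∷ []) , tt , v-L , tt) ,
      λ p p<i → +<+ (h-dec p<i (below-top i+j≡e))
      where L<h-i = below i (n<1+n i)

    arities-L : ∀ j i → arities (L i j) ≡ replicate j 2 ++ arities base
    arities-L zero i = refl
    arities-L (suc j) i = cong (2 ∷_) (trans (++-identityʳ (arities (L (suc i) j))) (arities-L j (suc i)))

-- SingleNNI t is OneThree (arities t) by definition.
OneThree : List ℕ → Set
OneThree ks = All (λ k → k ≡ 2 ⊎ k ≡ 3) ks × length (filter (_≟ 3) ks) ≡ 1

OneThree-3∷ : ∀ {ks} → All (_≡ 2) ks → OneThree (3 ∷ ks)
OneThree-3∷ twos =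
  inj₂ refl ∷ All.map inj₁ twos , cong (suc ∘ length) (filter-none (_≟ 3) (All.map (λ { refl () }) twos))

OneThree-++ : ∀ {ks ls} → All (_≡ 2) ks → OneThree ls → OneThree (ks ++ ls)
OneThree-++ [] one = one
OneThree-++ (refl ∷ twos) one with OneThree-++ twos one
... | all , count = inj₁ refl ∷ all , count

module IntermediateTreeConstruction (m a b : ℕ) (a+1<b : suc a < b) (b≤m : b ≤ m) where

  open Combs m

  a<b : a < b
  a<b = <-trans (n<1+n a) a+1<b

  b<n : b < n
  b<n = s≤s b≤m

  a<n : a < n
  a<n = <-trans a<b b<n

  open TurningPoint n a b a<b b<n

  g k : ℕ
  g = b ∸ suc (suc a)
  k = m ∸ b

  inner-top : suc (suc a) + g ≡ b
  inner-top = m+[n∸m]≡n a+1<b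

  upper-top : suc b + k ≡ n
  upper-top = cong suc (m+[n∸m]≡n b≤m)

  module Inner = RightComb V (leaf (label (suc a))) (suc a) (suc a) ≤-refl (Interval-label (<-trans a+1<b b<n))

  inner : Tree n
  inner = Inner.R g

  suc-a+g<b : suc a + g < b
  suc-a+g<b = subst (suc a + g <_) inner-top (n<1+n _)

  inner-interval : Interval (leaves inner) (suc a) b
  inner-interval = subst (Interval (leaves inner) (suc a)) inner-top (Inner.interval g (<-trans suc-a+g<b b<n))

  fork : Tree n
  fork = node (+ V b) (leaf (label a) ∷ inner ∷ leaf (label b) ∷ [])

  fork-interval : Interval (leaves fork) a (suc b)
  fork-interval = Interval-++ (n≤1+n a) (<⇒≤ (s≤s a<b)) (Interval-label a<n)
    (Interval-++ (<⇒≤ a+1<b) (n≤1+n b) inner-interval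
      (Interval-++ (n≤1+n b) ≤-refl (Interval-label b<n) (Interval-[] (suc b))))

  fork-LCA : ∀ {x y} → a ≤ toℕ x → toℕ x < toℕ y → toℕ y ≤ b → LCA fork x y (+ W (toℕ x) (toℕ y))
  fork-LCA {x} {y} a≤x x<y y≤b with m≤n⇒m<n∨m≡n a≤x | m≤n⇒m<n∨m≡n y≤b
  ... | inj₂ a≡x | _ = subst (LCA fork x y) (cong +_ W≡Vb)
      (LCA-node _ (proj₁ fork-interval) (here refl) (∈-label a<n (sym a≡x)) y∉leaf
        (from (proj₂ fork-interval) (<⇒≤ a<y , s≤s y≤b)))
    where
      a<y = subst (_< toℕ y) (sym a≡x) x<y
      W≡Vb : V b ≡ W (toℕ x) (toℕ y)
      W≡Vb = sym (trans (cong (λ i → W i (toℕ y)) (sym a≡x))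
                        (trans (W-a (<⇒≤ a<y)) (cong V (m≥n⇒m⊔n≡m y≤b))))
      y∉leaf : ¬ y ∈ leaves (leaf (label a))
      y∉leaf (here refl) = <-irrefl (sym (toℕ-label a<n)) a<y
  ... | inj₁ a<x | inj₁ y<b = subst (LCA fork x y) (cong +_ (sym (W-right a<x (<⇒≤ x<y) (<-trans y<b b<n))))
      (there (there (here refl))
        (Inner.LCA-R g (<-trans suc-a+g<b b<n) a<x x<y (≤-<-trans a<x x<y) (subst (toℕ y <_) (sym inner-top) y<b)))
  ... | inj₁ a<x | inj₂ y≡b = subst (LCA fork x y) (cong +_ W≡Vb)
      (LCA-sym (LCA-node _ (proj₁ fork-interval) (there (there (here refl))) (∈-label b<n y≡b) x∉leaf
        (from (proj₂ fork-interval) (<⇒≤ a<x , <-trans x<y (s≤s y≤b)))))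
    where
      W≡Vb : V b ≡ W (toℕ x) (toℕ y)
      W≡Vb = sym (trans (W-right a<x (<⇒≤ x<y) (<-≤-trans (s≤s y≤b) b<n)) (cong V y≡b))
      x∉leaf : ¬ x ∈ leaves (leaf (label b))
      x∉leaf (here refl) = <-irrefl (trans (toℕ-label b<n) (sym y≡b)) x<y

  module Upper = RightComb V fork a b (<⇒≤ a<b) fork-interval

  upper : Tree n
  upper = Upper.R k

  b+k<n : b + k < n
  b+k<n = subst (b + k <_) upper-top (n<1+n _)

  upper-interval : Interval (leaves upper) a n
  upper-interval = subst (Interval (leaves upper) a) upper-top (Upper.interval k b+k<n)

  upper-LCA : ∀ {x y} → a ≤ toℕ x → toℕ x < toℕ y → toℕ y < n → LCA upper x y (+ W (toℕ x) (toℕ y))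
  upper-LCA {x} {y} a≤x x<y y<n with toℕ y ≤? b
  ... | yes y≤b = Upper.lift k (fork-LCA a≤x x<y y≤b)
  ... | no y≰b = subst (LCA upper x y) (cong +_ (sym (W-beyond-a a≤x x<y (<⇒≤ b<y) y<n)))
      (Upper.LCA-R k b+k<n a≤x x<y b<y (subst (toℕ y <_) (sym upper-top) y<n))
    where b<y = ≰⇒> y≰b

  module Outer = LeftComb (U n) upper a n (<⇒≤ a<n) ≤-refl upper-interval

  tree : Tree n
  tree = Outer.L 0 a

  tree-LCA : ∀ {x y : Fin n} → toℕ x < toℕ y → LCA tree x y (+ W (toℕ x) (toℕ y))
  tree-LCA {x} {y} x<y with toℕ x <? a
  ... | yes x<a = subst (LCA tree x y) (cong +_ (sym (W-left x<a (<⇒≤ x<y) (toℕ<n y))))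
                    (Outer.LCA-L a 0 refl z≤n x<a x<y (toℕ<n y))
  ... | no x≮a = Outer.lift a 0 (upper-LCA (≮⇒≥ x≮a) x<y (toℕ<n y))

  inner-valid : Valid inner × hgt inner ℤ.≤ + V (suc a + g)
  inner-valid = Inner.valid V-increasing tt (+≤+ z≤n) g

  fork-valid : Valid fork
  fork-valid =
    s≤s (s≤s z≤n) , (0<Vb ∷ ℤ.≤-<-trans (proj₂ inner-valid) (+<+ (V-increasing suc-a+g<b)) ∷ 0<Vb ∷ []) ,
    tt , proj₁ inner-valid , tt , tt
    where 0<Vb = +<+ (<-≤-trans (≤-<-trans z≤n a<b) (m≤n+m b (scalar n a b)))

  upper-valid : Valid upper × hgt upper ℤ.≤ + V (b + k)
  upper-valid = Upper.valid V-increasing fork-valid ℤ.≤-refl k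

  tree-valid : Valid tree
  tree-valid = proj₁ (Outer.valid (λ p<q q<a → U-decreasing p<q (<-trans q<a a<n)) (proj₁ upper-valid)
    (λ p p<a → ℤ.≤-<-trans (proj₂ upper-valid) (+<+ (<-≤-trans (V<n+U-a b+k<n) (n+U≤U p<a a<n)))) a 0 refl)

  intermediate : IntermediateTree n (+ scalar n a b) tree
  intermediate = (tree-valid , Interval⇒↭allFin (Outer.interval a 0 refl)) ,
    0ℤ , λ x y x<y → subst (LCA tree x y) (sym (ℤ.+-identityʳ _)) (tree-LCA x<y)

  singleNNI : SingleNNI tree
  singleNNI = subst OneThree (sym arities-tree)
    (OneThree-++ (All.replicate⁺ a refl) (OneThree-++ (All.replicate⁺ k refl) (OneThree-3∷ inner-twos)))
    where
      arities-tree : arities tree ≡ replicate a 2 ++ replicate k 2 ++ 3 ∷ arities inner ++ []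
      arities-tree = trans (Outer.arities-L a 0) (cong (replicate a 2 ++_) (Upper.arities-R k))
      inner-twos : All (_≡ 2) (arities inner ++ [])
      inner-twos = All.++⁺ (subst (All (_≡ 2)) (sym (Inner.arities-R g)) (All.++⁺ (All.replicate⁺ g refl) [])) []

pairs : ℕ → List (ℕ × ℕ)
pairs zero = []
pairs (suc N) = pairs N ++ map (_, N) (upTo N)

∈-pairs⁻ : ∀ N {a c} → (a , c) ∈ pairs N → a < c × c < N
∈-pairs⁻ (suc N) p with ∈-++⁻ (pairs N) p
... | inj₁ q = proj₁ (∈-pairs⁻ N q) , m<n⇒m<1+n (proj₂ (∈-pairs⁻ N q))
... | inj₂ q with ∈-map⁻ (_, N) q
...   | _ , a∈ , refl = ∈-upTo⁻ a∈ , n<1+n N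

∈-pairs⁺ : ∀ N {a c} → a < c → c < N → (a , c) ∈ pairs N
∈-pairs⁺ (suc N) a<c c<1+N with m≤n⇒m<n∨m≡n (≤-pred c<1+N)
... | inj₁ c<N = ∈-++⁺ˡ (∈-pairs⁺ N a<c c<N)
... | inj₂ refl = ∈-++⁺ʳ (pairs N) (∈-map⁺ (_, N) (∈-upTo⁺ a<c))

pairs-unique : ∀ N → Unique (pairs N)
pairs-unique zero = []
pairs-unique (suc N) =
  Unique.++⁺ (pairs-unique N) (Unique.map⁺ (cong proj₁) (Unique.upTo⁺ N)) disjoint
  where
    disjoint : ∀ {p} → ¬ (p ∈ pairs N × p ∈ map (_, N) (upTo N))
    disjoint (p∈ , q) with ∈-map⁻ (_, N) q
    ... | _ , _ , refl = <-irrefl refl (proj₂ (∈-pairs⁻ N p∈))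

length-pairs : ∀ N → length (pairs N) ≡ N C 2
length-pairs zero = refl
length-pairs (suc N) = begin
  length (pairs N ++ map (_, N) (upTo N))          ≡⟨ length-++ (pairs N) ⟩
  length (pairs N) + length (map (_, N) (upTo N))  ≡⟨ cong₂ _+_ (length-pairs N) length-new ⟩
  N C 2 + N                                        ≡⟨ +-comm (N C 2) N ⟩
  N + N C 2                                        ≡⟨ cong (_+ N C 2) (nC1≡n N) ⟨
  N C 1 + N C 2                                    ≡⟨ nCk+nC[k+1]≡[n+1]C[k+1] N 1 ⟩
  suc N C 2                                        ∎
  where
    open ≡-Reasoning
    length-new = trans (length-map (_, N) (upTo N)) (length-upTo N)

map-unique : ∀ {A B : Set} {f : A → B} {xs} → (∀ {x y} → x ∈ xs → y ∈ xs → f x ≡ f y → x ≡ y) →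
             Unique xs → Unique (map f xs)
map-unique {xs = []} _ [] = []
map-unique {f = f} {xs = x ∷ xs} injective (x∉xs ∷ unique) =
  All.map⁺ (All.tabulate fx≢) ∷ map-unique (λ p q → injective (there p) (there q)) unique
  where
    fx≢ : ∀ {y} → y ∈ xs → f x ≢ f y
    fx≢ y∈xs fx≡fy = All.lookup x∉xs y∈xs (injective (here refl) (there y∈xs) fx≡fy)

-- The pair (a , c) stands for the turning point of (a , c + 1), so a + 1 < b = c + 1 ≤ m.
nni-scalars : ℕ → List ℤ
nni-scalars m = map (λ (a , c) → + scalar (suc m) a (suc c)) (pairs m)

module _ (m : ℕ) where

  private
    n : ℕ
    n = suc m

  ∈-nni-scalars⁻ : ∀ {l} → l ∈ nni-scalars m → ∃₂ λ a b → suc a < b × b ≤ m × l ≡ + scalar n a b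
  ∈-nni-scalars⁻ l∈ with ∈-map⁻ _ l∈
  ... | (a , c) , ac∈ , refl with ∈-pairs⁻ m ac∈
  ...   | a<c , c<m = a , suc c , s≤s a<c , c<m , refl

  ∈-nni-scalars⁺ : ∀ {a b} → suc a < b → b ≤ m → + scalar n a b ∈ nni-scalars m
  ∈-nni-scalars⁺ {b = suc c} (s≤s a<c) c<m = ∈-map⁺ _ (∈-pairs⁺ m a<c c<m)

  nni-scalars-unique : Unique (nni-scalars m)
  nni-scalars-unique = map-unique injective (pairs-unique m)
    where
      injective : ∀ {p q} → p ∈ pairs m → q ∈ pairs m → _ → p ≡ q
      injective p∈ q∈ eq with ∈-pairs⁻ m p∈ | ∈-pairs⁻ m q∈
      ... | a<c , c<m | a′<c′ , c′<m
        with refl , refl ← scalar-injective (m<n⇒m<1+n a<c) (s≤s c<m) (m<n⇒m<1+n a′<c′) (s≤s c′<m)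
                                            (ℤ.+-injective eq)
        = refl

  length-nni-scalars : length (nni-scalars m) ≡ m C 2
  length-nni-scalars = trans (length-map _ (pairs m)) (length-pairs m)

  single-NNI-at : ∀ {a b} → suc a < b → b ≤ m →
    InΛ n (+ scalar n a b) × ∃ λ T → IntermediateTree n (+ scalar n a b) T × SingleNNI T
  single-NNI-at {a} {b} a+1<b b≤m = (label a , label b , a<b′ , sym Λ≡) , tree , intermediate , singleNNI
    where
      open IntermediateTreeConstruction m a b a+1<b b≤m
      open Combs m using (label; toℕ-label)
      a<b′ : toℕ (label a) < toℕ (label b)
      a<b′ = subst₂ _<_ (sym (toℕ-label a<n)) (sym (toℕ-label b<n)) a<b
      Λ≡ : u n (label a) (label b) - v n (label a) (label b) ≡ + scalar n a b
      Λ≡ = trans (Λ≡scalar a<b′) (cong₂ (λ p q → + scalar n p q) (toℕ-label a<n) (toℕ-label b<n))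

  single-NNI⇒∈ : ∀ {l T} → InΛ n l → IntermediateTree n l T → SingleNNI T → l ∈ nni-scalars m
  single-NNI⇒∈ {T = T} (i , j , i<j , l≡) intermediate single with trans l≡ (Λ≡scalar i<j)
  ... | refl = ∈-nni-scalars⁺ (IntermediateTreeProperties.single-NNI⇒gap i j i<j T intermediate single)
                               (≤-pred (toℕ<n j))

  ∈-nni-scalars⇔ : ∀ l → l ∈ nni-scalars m ⇔ (InΛ n l × ∃ λ T → IntermediateTree n l T × SingleNNI T)
  ∈-nni-scalars⇔ l =
    mk⇔ single-NNI-of (λ (l∈Λ , _ , intermediate , single) → single-NNI⇒∈ l∈Λ intermediate single)
    where
      single-NNI-of : l ∈ nni-scalars m → InΛ n l × ∃ λ T → IntermediateTree n l T × SingleNNI T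
      single-NNI-of l∈ with ∈-nni-scalars⁻ l∈
      ... | a , b , a+1<b , b≤m , refl = single-NNI-at a+1<b b≤m

  no-four-clade : ∀ l → InΛ n l → ∀ T → IntermediateTree n l T → ¬ FourClade T
  no-four-clade l (i , j , i<j , l≡) T intermediate with trans l≡ (Λ≡scalar i<j)
  ... | refl = IntermediateTreeProperties.no-four-clade i j i<j T intermediate

theorem5p1 : (n : ℕ) → 2 ≤ n →
    Σ (List ℤ) (λ L → Unique L
      × (∀ (l : ℤ) → (l ∈ L) ⇔ (InΛ n l × ∃ (λ T → IntermediateTree n l T × SingleNNI T)))
      × length L ≡ (n ∸ 1) C 2)
    × (∀ (l : ℤ) → InΛ n l → ∀ (T : Tree n) → IntermediateTree n l T → ¬ FourClade T)
theorem5p1 zero ()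
theorem5p1 (suc m) _ =
  (nni-scalars m , nni-scalars-unique m , ∈-nni-scalars⇔ m , length-nni-scalars m) , no-four-clade m
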